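{- (Soundness of $\mathbf{GBU}(G)$.) For every formula $G$: if the sequent $\emptyset\Rightarrow_g G$ is derivable in $\mathbf{GBU}(G)$, then $G$ is valid in intuitionistic propositional logic.
   Context: Formulas are built from a countably infinite set of propositional variables and $\bot$ using $\land,\lor,\supset$. For a formula $G$, $\mathrm{Sl}(G)$ and $\mathrm{Sr}(G)$ are the smallest subsets of the subformulas of $G$ with: $G\in\mathrm{Sr}(G)$; $A\land B$ or $A\lor B$ in $\mathrm{Sl}(G)$ (resp. $\mathrm{Sr}(G)$) implies $A,B$ in $\mathrm{Sl}(G)$ (resp. $\mathrm{Sr}(G)$); $A\supset B\in\mathrm{Sl}(G)$ implies $B\in\mathrm{Sl}(G)$, $A\in\mathrm{Sr}(G)$; $A\supset B\in\mathrm{Sr}(G)$ implies $B\in\mathrm{Sr}(G)$, $A\in\mathrm{Sl}(G)$. $\mathrm{Cl}(\Gamma)$ is the smallest set containing $\Gamma$ such that if $X,Y\in\mathrm{Cl}(\Gamma)$ and $A$ is any formula then $X\land Y,A\lor X,X\lor A,A\supset X\in\mathrm{Cl}(\Gamma)$. Commas denote union. $\mathbf{GBU}(G)$: sequents regular $\Psi\Rightarrow_g A$ and irregular $\Psi\rightarrow_g A$ with $\Psi\subseteq\mathrm{Sl}(G)$, $A\in\mathrm{Sr}(G)$ (all sequents in rules satisfy this). Rules ($k\in\{1,2\}$): axioms $A,\Psi\Rightarrow_g A$, $\bot,\Psi\Rightarrow_g C$, $A,\Psi\rightarrow_g A$; $L\land$: $A,B,\Psi\Rightarrow_g C/A\land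 B,\Psi\Rightarrow_g C$; $R\land$: $\Psi\Rightarrow_g A$, $\Psi\Rightarrow_g B/\Psi\Rightarrow_g A\land B$ and likewise with $\rightarrow_g$ throughout; $L\lor$: $A,\Psi\Rightarrow_g C$, $B,\Psi\Rightarrow_g C/A\lor B,\Psi\Rightarrow_g C$; $R\lor_k$: $\Psi\rightarrow_g C_k/\Psi\Rightarrow_g C_1\lor C_2$ and $\Psi\rightarrow_g C_k/\Psi\rightarrow_g C_1\lor C_2$; $L\supset$: $A\supset B,\Psi\rightarrow_g A$, $B,\Psi\Rightarrow_g C/A\supset B,\Psi\Rightarrow_g C$; $\supset R_\in$: $\Psi\Rightarrow_g B/\Psi\Rightarrow_g A\supset B$ and $\Psi\rightarrow_g B/\Psi\rightarrow_g A\supset B$, if $A\in\mathrm{Cl}(\Psi)$; $\supset R_{\notin}$: $A,\Psi\Rightarrow_g B/\Psi\Rightarrow_g A\supset B$ and $A,\Psi\Rightarrow_g B/\Psi\rightarrow_g A\supset B$, if $A\notin\mathrm{Cl}(\Psi)$. -}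

module Defs where

open import Data.Nat using (ℕ)
open import Data.List using (List; []; _∷_)
open import Data.List.Membership.Propositional using (_∈_)
open import Data.List.Relation.Unary.All using (All)
open import Data.Product using (_×_)
open import Relation.Nullary using (¬_)

data Formula : Set where
  var  : ℕ → Formula
  ⊥f   : Formula
  _∧_  : Formula → Formula → Formula
  _∨_  : Formula → Formula → Formula
  _⊃_  : Formula → Formula → Formula

infixr 6 _∧_
infixr 5 _∨_
infixr 4 _⊃_

mutual
  data Sl (G : Formula) : Formula → Set where
    sl-∧₁ : ∀ {A B} → Sl G (A ∧ B) → Sl G A
    sl-∧₂ : ∀ {A B} → Sl G (A ∧ B) → Sl G B
    sl-∨₁ : ∀ {A B} → Sl G (A ∨ B) → Sl G A
    sl-∨₂ : ∀ {A B} → Sl G (A ∨ B) → Sl G B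
    sl-⊃  : ∀ {A B} → Sl G (A ⊃ B) → Sl G B
    sr-⊃  : ∀ {A B} → Sr G (A ⊃ B) → Sl G A

  data Sr (G : Formula) : Formula → Set where
    sr-G  : Sr G G
    sr-∧₁ : ∀ {A B} → Sr G (A ∧ B) → Sr G A
    sr-∧₂ : ∀ {A B} → Sr G (A ∧ B) → Sr G B
    sr-∨₁ : ∀ {A B} → Sr G (A ∨ B) → Sr G A
    sr-∨₂ : ∀ {A B} → Sr G (A ∨ B) → Sr G B
    sr-⊃r : ∀ {A B} → Sr G (A ⊃ B) → Sr G B
    sl-⊃l : ∀ {A B} → Sl G (A ⊃ B) → Sr G A

data Cl (Γ : List Formula) : Formula → Set where
  cl-base : ∀ {X} → X ∈ Γ → Cl Γ X
  cl-∧    : ∀ {X Y} → Cl Γ X → Cl Γ Y → Cl Γ (X ∧ Y)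
  cl-∨l   : ∀ {X} (A : Formula) → Cl Γ X → Cl Γ (A ∨ X)
  cl-∨r   : ∀ {X} (A : Formula) → Cl Γ X → Cl Γ (X ∨ A)
  cl-⊃    : ∀ {X} (A : Formula) → Cl Γ X → Cl Γ (A ⊃ X)

-- Contexts are finite sets represented by lists; two lists denote the same set
-- when they have the same members.
_≈ₛ_ : List Formula → List Formula → Set
Ψ ≈ₛ Φ = (∀ {x} → x ∈ Ψ → x ∈ Φ) × (∀ {x} → x ∈ Φ → x ∈ Ψ)

-- Sequent arrows: regular ⇒g and irregular →g.
data Arrow : Set where
  reg irr : Arrow

WF : Formula → List Formula → Formula → Set
WF G Ψ A = All (Sl G) Ψ × Sr G A

-- The rule 'set' identifies contexts with the same members (commas = union).
data GBU (G : Formula) : Arrow → List Formula → Formula → Set where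
  set    : ∀ {k Ψ Φ C} → Ψ ≈ₛ Φ → WF G Φ C → GBU G k Ψ C → GBU G k Φ C
  ax     : ∀ {Ψ A} → WF G (A ∷ Ψ) A → GBU G reg (A ∷ Ψ) A
  ax⊥    : ∀ {Ψ C} → WF G (⊥f ∷ Ψ) C → GBU G reg (⊥f ∷ Ψ) C
  axI    : ∀ {Ψ A} → WF G (A ∷ Ψ) A → GBU G irr (A ∷ Ψ) A
  L∧     : ∀ {Ψ A B C} → WF G ((A ∧ B) ∷ Ψ) C →
           GBU G reg (A ∷ B ∷ Ψ) C → GBU G reg ((A ∧ B) ∷ Ψ) C
  R∧     : ∀ {k Ψ A B} → WF G Ψ (A ∧ B) →
           GBU G k Ψ A → GBU G k Ψ B → GBU G k Ψ (A ∧ B)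
  L∨     : ∀ {Ψ A B C} → WF G ((A ∨ B) ∷ Ψ) C →
           GBU G reg (A ∷ Ψ) C → GBU G reg (B ∷ Ψ) C → GBU G reg ((A ∨ B) ∷ Ψ) C
  R∨₁    : ∀ {k Ψ C₁ C₂} → WF G Ψ (C₁ ∨ C₂) →
           GBU G irr Ψ C₁ → GBU G k Ψ (C₁ ∨ C₂)
  R∨₂    : ∀ {k Ψ C₁ C₂} → WF G Ψ (C₁ ∨ C₂) →
           GBU G irr Ψ C₂ → GBU G k Ψ (C₁ ∨ C₂)
  L⊃     : ∀ {Ψ A B C} → WF G ((A ⊃ B) ∷ Ψ) C →
           GBU G irr ((A ⊃ B) ∷ Ψ) A → GBU G reg (B ∷ Ψ) C → GBU G reg ((A ⊃ B) ∷ Ψ) C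
  ⊃R∈    : ∀ {k Ψ A B} → WF G Ψ (A ⊃ B) → Cl Ψ A →
           GBU G k Ψ B → GBU G k Ψ (A ⊃ B)
  ⊃R∉    : ∀ {k Ψ A B} → WF G Ψ (A ⊃ B) → ¬ Cl Ψ A →
           GBU G reg (A ∷ Ψ) B → GBU G k Ψ (A ⊃ B)

data _⊢_ (Γ : List Formula) : Formula → Set where
  hyp  : ∀ {A} → A ∈ Γ → Γ ⊢ A
  ⊥E   : ∀ {A} → Γ ⊢ ⊥f → Γ ⊢ A
  ∧I   : ∀ {A B} → Γ ⊢ A → Γ ⊢ B → Γ ⊢ A ∧ B
  ∧E₁  : ∀ {A B} → Γ ⊢ A ∧ B → Γ ⊢ A
  ∧E₂  : ∀ {A B} → Γ ⊢ A ∧ B → Γ ⊢ B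
  ∨I₁  : ∀ {A B} → Γ ⊢ A → Γ ⊢ A ∨ B
  ∨I₂  : ∀ {A B} → Γ ⊢ B → Γ ⊢ A ∨ B
  ∨E   : ∀ {A B C} → Γ ⊢ A ∨ B → (A ∷ Γ) ⊢ C → (B ∷ Γ) ⊢ C → Γ ⊢ C
  ⊃I   : ∀ {A B} → (A ∷ Γ) ⊢ B → Γ ⊢ A ⊃ B
  ⊃E   : ∀ {A B} → Γ ⊢ A ⊃ B → Γ ⊢ A → Γ ⊢ B

infix 2 _⊢_

IPC-valid : Formula → Set
IPC-valid G = [] ⊢ G

-- Every GBU(G) rule is an admissible inference of natural deduction once the
-- arrow is forgotten: regular and irregular sequents both read as Ψ ⊢ C, the
-- side conditions (Sl/Sr, Cl) are ignored, ⊃R∈ is ⊃-introduction with a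
-- vacuous discharge, and the left rules are eliminations applied to the
-- principal hypothesis followed by a cut.
module Submission where

open import Defs
open import Data.List using ([]; _∷_)
open import Data.List.Relation.Binary.Subset.Propositional using (_⊆_)
open import Data.List.Relation.Binary.Subset.Propositional.Properties
  using (xs⊆x∷xs; ∷⁺ʳ; ∈-∷⁺ʳ)
open import Data.List.Relation.Unary.Any using (here; there)
open import Data.Product using (proj₁)
open import Relation.Binary.PropositionalEquality using (refl)

⊢-mono : ∀ {Γ Δ A} → Γ ⊆ Δ → Γ ⊢ A → Δ ⊢ A
⊢-mono Γ⊆Δ (hyp A∈Γ)  = hyp (Γ⊆Δ A∈Γ)
⊢-mono Γ⊆Δ (⊥E d)     = ⊥E (⊢-mono Γ⊆Δ d)
⊢-mono Γ⊆Δ (∧I d e)   = ∧I (⊢-mono Γ⊆Δ d) (⊢-mono Γ⊆Δ e)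
⊢-mono Γ⊆Δ (∧E₁ d)    = ∧E₁ (⊢-mono Γ⊆Δ d)
⊢-mono Γ⊆Δ (∧E₂ d)    = ∧E₂ (⊢-mono Γ⊆Δ d)
⊢-mono Γ⊆Δ (∨I₁ d)    = ∨I₁ (⊢-mono Γ⊆Δ d)
⊢-mono Γ⊆Δ (∨I₂ d)    = ∨I₂ (⊢-mono Γ⊆Δ d)
⊢-mono Γ⊆Δ (∨E d e f) = ∨E (⊢-mono Γ⊆Δ d) (⊢-mono (∷⁺ʳ _ Γ⊆Δ) e) (⊢-mono (∷⁺ʳ _ Γ⊆Δ) f)
⊢-mono Γ⊆Δ (⊃I d)     = ⊃I (⊢-mono (∷⁺ʳ _ Γ⊆Δ) d)
⊢-mono Γ⊆Δ (⊃E d e)   = ⊃E (⊢-mono Γ⊆Δ d) (⊢-mono Γ⊆Δ e)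

⊢-weaken : ∀ {Γ A B} → Γ ⊢ A → B ∷ Γ ⊢ A
⊢-weaken = ⊢-mono (xs⊆x∷xs _ _)

⊢-cut : ∀ {Γ A C} → Γ ⊢ A → A ∷ Γ ⊢ C → Γ ⊢ C
⊢-cut d e = ⊃E (⊃I e) d

⊢-head : ∀ {Γ A} → A ∷ Γ ⊢ A
⊢-head = hyp (here refl)

⊢-replace-head : ∀ {Γ A B C} → B ∷ Γ ⊢ C → B ∷ A ∷ Γ ⊢ C
⊢-replace-head = ⊢-mono (∷⁺ʳ _ (xs⊆x∷xs _ _))

L∧-admissible : ∀ {Γ A B C} → A ∷ B ∷ Γ ⊢ C → (A ∧ B) ∷ Γ ⊢ C
L∧-admissible {Γ} {A} {B} d =
  ⊢-cut (∧E₁ ⊢-head) (⊢-cut (⊢-weaken (∧E₂ ⊢-head)) (⊢-mono reorder d))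
  where
    reorder : A ∷ B ∷ Γ ⊆ B ∷ A ∷ (A ∧ B) ∷ Γ
    reorder = ∈-∷⁺ʳ (there (here refl)) (∷⁺ʳ B (λ x∈Γ → there (there x∈Γ)))

L∨-admissible : ∀ {Γ A B C} → A ∷ Γ ⊢ C → B ∷ Γ ⊢ C → (A ∨ B) ∷ Γ ⊢ C
L∨-admissible d e = ∨E ⊢-head (⊢-replace-head d) (⊢-replace-head e)

L⊃-admissible : ∀ {Γ A B C} → (A ⊃ B) ∷ Γ ⊢ A → B ∷ Γ ⊢ C → (A ⊃ B) ∷ Γ ⊢ C
L⊃-admissible d e = ⊢-cut (⊃E ⊢-head d) (⊢-replace-head e)

GBU-sound : ∀ {G k Ψ C} → GBU G k Ψ C → Ψ ⊢ C
GBU-sound (set Ψ≈Φ _ d)  = ⊢-mono (proj₁ Ψ≈Φ) (GBU-sound d)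
GBU-sound (ax _)         = ⊢-head
GBU-sound (ax⊥ _)        = ⊥E ⊢-head
GBU-sound (axI _)        = ⊢-head
GBU-sound (L∧ _ d)       = L∧-admissible (GBU-sound d)
GBU-sound (R∧ _ d e)     = ∧I (GBU-sound d) (GBU-sound e)
GBU-sound (L∨ _ d e)     = L∨-admissible (GBU-sound d) (GBU-sound e)
GBU-sound (R∨₁ _ d)      = ∨I₁ (GBU-sound d)
GBU-sound (R∨₂ _ d)      = ∨I₂ (GBU-sound d)
GBU-sound (L⊃ _ d e)     = L⊃-admissible (GBU-sound d) (GBU-sound e)
GBU-sound (⊃R∈ _ _ d)    = ⊃I (⊢-weaken (GBU-sound d))
GBU-sound (⊃R∉ _ _ d)    = ⊃I (GBU-sound d)

theorem5p2 : (G : Formula) → GBU G reg [] G → IPC-valid G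
theorem5p2 G = GBU-sound
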